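{- Let $(G,T)$ be a connected bipartite graft and let $e$ be an edge between distinct vertices $x$ and $y$. If $e$ is not allowed, then $d_{(G,T)}(x,y)=1$.
   Context: A graft is a pair $(G,T)$ with $G$ a finite (multi)graph, $T\subseteq V(G)$, each connected component of $G$ containing an even number of vertices of $T$; grafts are assumed connected. A join is $F\subseteq E(G)$ such that each vertex of $T$ meets an odd number and each vertex of $V(G)\setminus T$ an even number of edges of $F$; a minimum join has fewest edges. An edge is allowed if some minimum join contains it. $w_F(e)=-1$ for $e\in F$, $1$ otherwise; $w_F(P)=\sum_{e\in E(P)}w_F(e)$. For a minimum join $F$, $d_{(G,T)}(u,v)$ is the minimum $F$-weight of a path between $u,v$ (independent of $F$). -}

module Defs where

open import Data.Nat using (ℕ; zero; suc; _+_; _%_)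
open import Data.Bool using (Bool; true; false; if_then_else_)
open import Data.Fin using (Fin; _≟_)
open import Data.List using (List; []; _∷_; map; allFin)
open import Data.Nat.ListAction using (sum)
open import Data.Product using (_×_; _,_; proj₁; proj₂; Σ; ∃-syntax)
open import Data.Sum using (_⊎_)
open import Data.Integer as ℤ using (ℤ; +_; -_)
open import Relation.Binary.PropositionalEquality using (_≡_; _≢_)
open import Relation.Nullary.Decidable using (⌊_⌋)
open import Data.List.Relation.Unary.Unique.Propositional using (Unique)

record Graph : Set where
  field
    n    : ℕ
    m    : ℕ
    ends : Fin m → Fin n × Fin n
open Graph public

Vtx : Graph → Set
Vtx G = Fin (n G)

Edge : Graph → Set
Edge G = Fin (m G)

count : {k : ℕ} → (Fin k → Bool) → ℕ
count {k} P = sum (map (λ i → if P i then 1 else 0) (allFin k))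

Joins : (G : Graph) → Edge G → Vtx G → Vtx G → Set
Joins G e u w = (ends G e ≡ (u , w)) ⊎ (ends G e ≡ (w , u))

data Walk (G : Graph) : Vtx G → Vtx G → Set where
  []   : {v : Vtx G} → Walk G v v
  step : {u w v : Vtx G} (e : Edge G) → Joins G e u w → Walk G w v → Walk G u v

vertices : {G : Graph} {u v : Vtx G} → Walk G u v → List (Vtx G)
vertices {u = u} []           = u ∷ []
vertices {u = u} (step e _ p) = u ∷ vertices p

edgesOf : {G : Graph} {u v : Vtx G} → Walk G u v → List (Edge G)
edgesOf []           = []
edgesOf (step e _ p) = e ∷ edgesOf p

IsPath : {G : Graph} {u v : Vtx G} → Walk G u v → Set
IsPath p = Unique (vertices p)

Connected : Graph → Set
Connected G = (u v : Vtx G) → Walk G u v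

Bipartite : Graph → Set
Bipartite G = Σ (Vtx G → Bool) λ c → (e : Edge G) → c (proj₁ (ends G e)) ≢ c (proj₂ (ends G e))

IsGraft : (G : Graph) → (Vtx G → Bool) → Set
IsGraft G T = Connected G × (count T % 2 ≡ 0)

-- number of ends of edge e at vertex v (a loop counts twice)
incid : (G : Graph) → Edge G → Vtx G → ℕ
incid G e v = (if ⌊ proj₁ (ends G e) ≟ v ⌋ then 1 else 0)
            + (if ⌊ proj₂ (ends G e) ≟ v ⌋ then 1 else 0)

degIn : (G : Graph) → (Edge G → Bool) → Vtx G → ℕ
degIn G F v = sum (map (λ e → if F e then incid G e v else 0) (allFin (m G)))

IsJoin : (G : Graph) → (Vtx G → Bool) → (Edge G → Bool) → Set
IsJoin G T F = (v : Vtx G) → degIn G F v % 2 ≡ (if T v then 1 else 0)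

IsMinJoin : (G : Graph) → (Vtx G → Bool) → (Edge G → Bool) → Set
IsMinJoin G T F = IsJoin G T F × ((F' : Edge G → Bool) → IsJoin G T F' → count F Data.Nat.≤ count F')

Allowed : (G : Graph) → (Vtx G → Bool) → Edge G → Set
Allowed G T e = ∃[ F ] (IsMinJoin G T F × F e ≡ true)

wt : {G : Graph} → (Edge G → Bool) → Edge G → ℤ
wt F e = if F e then ℤ.-[1+ 0 ] else + 1

wtWalk : {G : Graph} {u v : Vtx G} → (Edge G → Bool) → Walk G u v → ℤ
wtWalk F []           = + 0
wtWalk {G} F (step e _ p) = wt {G} F e ℤ.+ wtWalk F p

-- d_(G,T)(u,v) = k, computed with respect to the minimum join F:
-- k is the minimum F-weight of a u–v path.
DistIs : (G : Graph) → (Edge G → Bool) → Vtx G → Vtx G → ℤ → Set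
DistIs G F u v k =
  (Σ (Walk G u v) λ P → IsPath P × wtWalk F P ≡ k)
  × ((P : Walk G u v) → IsPath P → k ℤ.≤ wtWalk F P)

{-# OPTIONS --safe #-}
module Submission where

-- Since e is not allowed, F avoids e, so e alone is an x–y path of F-weight 1.  Any other
-- x–y path P avoids e and closes up with e into a cycle C.  The symmetric difference
-- F Δ E(C) is again a join (C has even degree everywhere), it contains e, and it has
-- |F| + w_F(C) edges; minimality of F and non-allowedness of e therefore force
-- w_F(C) = 1 + w_F(P) > 0.  In a bipartite graph every x–y walk has odd length, hence odd
-- F-weight, so w_F(P) ≥ 1.

open import Defs
open import Algebra.Bundles using (CommutativeMonoid)
open import Data.Bool using (Bool; true; false; if_then_else_; not; _xor_)
open import Data.Bool.Properties using (if-float; xor-same; not-distribˡ-xor; ¬-not)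
open import Data.Empty using (⊥-elim)
open import Data.Fin using (Fin; zero; suc; _≟_)
open import Data.Integer as ℤ using (ℤ; +_; -[1+_]; 0ℤ; 1ℤ; -1ℤ; +≤+; -≤-)
import Data.Integer.Properties as ℤₚ
open import Data.Integer.Tactic.RingSolver using (solve-∀)
open import Data.List using (map; tabulate; allFin)
open import Data.List.Membership.Propositional using (_∈_)
open import Data.List.Relation.Unary.All as All using (All; []; _∷_)
open import Data.List.Relation.Unary.AllPairs using ([]; _∷_)
open import Data.List.Relation.Unary.Any using (here; there)
open import Data.List.Relation.Unary.Unique.Propositional using (Unique)
open import Data.Nat as ℕ using (ℕ; zero; suc; _%_; z≤n; s≤s)
import Data.Nat.ListAction as ListAction
import Data.Nat.Properties as ℕₚ
open import Data.Parity.Base as ℙ using (Parity; 0ℙ; 1ℙ)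
import Data.Parity.Properties as ℙₚ
open import Data.Product using (_,_; proj₁; proj₂; ∃-syntax)
open import Data.Sum using (_⊎_; inj₁; inj₂)
open import Data.Vec.Functional using (Vector)
open import Function using (_∘_; id)
open import Relation.Binary.PropositionalEquality
  using (_≡_; _≢_; refl; sym; trans; cong; cong₂; subst; module ≡-Reasoning)
open import Relation.Nullary using (¬_; yes; no; contradiction)
open import Relation.Nullary.Decidable using (⌊_⌋; ⌊⌋-map′)

module RestrictedSum {c ℓ} (M : CommutativeMonoid c ℓ) where

  open CommutativeMonoid M
    using (Carrier; _≈_; setoid; ∙-congˡ; identityˡ; identityʳ)
    renaming (_∙_ to _+_; ε to 0#; sym to ≈-sym; trans to ≈-trans)
  open import Algebra.Properties.CommutativeMonoid.Sum M public
    using (sum; sum-cong-≋; sum-cong-≗; sum-replicate-zero; ∑-distrib-+)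
  open import Relation.Binary.Reasoning.Setoid setoid

  restrict : ∀ {k} → (Fin k → Bool) → Vector Carrier k → Vector Carrier k
  restrict S f i = if S i then f i else 0#

  sum-restrict-singleton : ∀ {k} (e : Fin k) (f : Vector Carrier k) →
    sum (restrict (λ i → ⌊ i ≟ e ⌋) f) ≈ f e
  sum-restrict-singleton {suc k} zero f = begin
    f zero + sum {k} (λ _ → 0#)  ≈⟨ ∙-congˡ (sum-replicate-zero k) ⟩
    f zero + 0#                  ≈⟨ identityʳ (f zero) ⟩
    f zero                       ∎
  sum-restrict-singleton {suc k} (suc e) f = begin
    0# + sum (restrict (λ i → ⌊ suc i ≟ suc e ⌋) (f ∘ suc))
      ≈⟨ identityˡ _ ⟩
    sum (restrict (λ i → ⌊ suc i ≟ suc e ⌋) (f ∘ suc))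
      ≡⟨ sum-cong-≗ (λ i → cong (λ b → if b then f (suc i) else 0#) (⌊⌋-map′ _ _ (i ≟ e))) ⟩
    sum (restrict (λ i → ⌊ i ≟ e ⌋) (f ∘ suc))
      ≈⟨ sum-restrict-singleton e (f ∘ suc) ⟩
    f (suc e) ∎

  sum-restrict-xor : ∀ {k} (S S′ : Fin k → Bool) (f : Vector Carrier k) →
    (∀ i → S i ≡ true → S′ i ≡ true → f i + f i ≈ 0#) →
    sum (restrict (λ i → S i xor S′ i) f) ≈ sum (restrict S f) + sum (restrict S′ f)
  sum-restrict-xor S S′ f self-inverse =
    ≈-trans (sum-cong-≋ pointwise) (∑-distrib-+ (restrict S f) (restrict S′ f))
    where
    pointwise : ∀ i → restrict (λ i → S i xor S′ i) f i ≈ restrict S f i + restrict S′ f i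
    pointwise i with S i in s | S′ i in s′
    ... | true  | true  = ≈-sym (self-inverse i s s′)
    ... | true  | false = ≈-sym (identityʳ (f i))
    ... | false | true  = ≈-sym (identityˡ (f i))
    ... | false | false = ≈-sym (identityˡ 0#)

  homomorphic-sum-allFin : (h : ℕ → Carrier) → h 0 ≈ 0# → (∀ a b → h (a ℕ.+ b) ≈ h a + h b) →
    ∀ {k} (f : Fin k → ℕ) → h (ListAction.sum (map f (allFin k))) ≈ sum (h ∘ f)
  homomorphic-sum-allFin h h-0 h-+ f = sum-tabulate f id
    where
    sum-tabulate : ∀ {A : Set} {k} (f : A → ℕ) (g : Fin k → A) →
      h (ListAction.sum (map f (tabulate g))) ≈ sum (h ∘ f ∘ g)
    sum-tabulate {k = zero}  f g = h-0
    sum-tabulate {k = suc k} f g = ≈-trans (h-+ _ _) (∙-congˡ (sum-tabulate f (g ∘ suc)))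

module ℤΣ = RestrictedSum ℤₚ.+-0-commutativeMonoid
module ℙΣ = RestrictedSum ℙₚ.+-0-commutativeMonoid

ℙ+-cancel-middle : ∀ p q r → (p ℙ.+ q) ℙ.+ (q ℙ.+ r) ≡ p ℙ.+ r
ℙ+-cancel-middle p q r = begin
  (p ℙ.+ q) ℙ.+ (q ℙ.+ r)  ≡⟨ ℙₚ.+-assoc p q (q ℙ.+ r) ⟩
  p ℙ.+ (q ℙ.+ (q ℙ.+ r))  ≡⟨ cong (p ℙ.+_) (sym (ℙₚ.+-assoc q q r)) ⟩
  p ℙ.+ ((q ℙ.+ q) ℙ.+ r)  ≡⟨ cong (λ s → p ℙ.+ (s ℙ.+ r)) (ℙₚ.p+p≡0ℙ q) ⟩
  p ℙ.+ r                  ∎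
  where open ≡-Reasoning

parity-sum-allFin : ∀ {k} (f : Fin k → ℕ) →
  ℕ.parity (ListAction.sum (map f (allFin k))) ≡ ℙΣ.sum (ℕ.parity ∘ f)
parity-sum-allFin = ℙΣ.homomorphic-sum-allFin ℕ.parity refl ℙₚ.+-homo-+

parity⇒%2≡ : ∀ {m n} → ℕ.parity m ≡ ℕ.parity n → m % 2 ≡ n % 2
parity⇒%2≡ {m} {n} eq = trans (%2≡ m) (trans (cong toℕ eq) (sym (%2≡ n)))
  where
  toℕ : Parity → ℕ
  toℕ 0ℙ = 0
  toℕ 1ℙ = 1
  %2≡ : ∀ k → k % 2 ≡ toℕ (ℕ.parity k)
  %2≡ 0             = refl
  %2≡ 1             = refl
  %2≡ (suc (suc k)) = %2≡ k

xor-≢ : ∀ {a b} → a ≢ b → a xor b ≡ true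
xor-≢ {true}  {true}  a≢b = contradiction refl a≢b
xor-≢ {true}  {false} _   = refl
xor-≢ {false} {true}  _   = refl
xor-≢ {false} {false} a≢b = contradiction refl a≢b

indicator : Bool → ℕ
indicator b = if b then 1 else 0

OddIf : Bool → ℤ → Set
OddIf false i = ∃[ k ] i ≡ k ℤ.+ k
OddIf true  i = ∃[ k ] i ≡ 1ℤ ℤ.+ (k ℤ.+ k)

OddIf-±1+ : ∀ s b {i} → OddIf b i → OddIf (not b) ((if s then -1ℤ else 1ℤ) ℤ.+ i)
OddIf-±1+ false false (k , refl) = k , refl
OddIf-±1+ false true  (k , refl) = k ℤ.+ 1ℤ , eq k
  where eq : ∀ k → 1ℤ ℤ.+ (1ℤ ℤ.+ (k ℤ.+ k)) ≡ (k ℤ.+ 1ℤ) ℤ.+ (k ℤ.+ 1ℤ)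
        eq = solve-∀
OddIf-±1+ true  false (k , refl) = k ℤ.- 1ℤ , eq k
  where eq : ∀ k → ℤ.- 1ℤ ℤ.+ (k ℤ.+ k) ≡ 1ℤ ℤ.+ ((k ℤ.- 1ℤ) ℤ.+ (k ℤ.- 1ℤ))
        eq = solve-∀
OddIf-±1+ true  true  (k , refl) = k , eq k
  where eq : ∀ k → ℤ.- 1ℤ ℤ.+ (1ℤ ℤ.+ (k ℤ.+ k)) ≡ k ℤ.+ k
        eq = solve-∀

odd-positive : ∀ {i} → OddIf true i → 0ℤ ℤ.< 1ℤ ℤ.+ i → 1ℤ ℤ.≤ i
odd-positive {+ 0}      (k , i≡1+2k) _ = ⊥-elim (odd≢0 k (sym i≡1+2k))
  where
  odd≢0 : ∀ k → 1ℤ ℤ.+ (k ℤ.+ k) ≢ 0ℤ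
  odd≢0 (+ n)           ()
  odd≢0 -[1+ zero ]     ()
  odd≢0 -[1+ suc n ]    ()
odd-positive {+ suc n}  _ _   = +≤+ (s≤s z≤n)
odd-positive { -[1+ n ]} _ 0<1+i = contradiction (ℤₚ.+-monoʳ-≤ 1ℤ (-≤- {m = n} z≤n)) (ℤₚ.<⇒≱ 0<1+i)

+-gap-positive : ∀ {a b i} → + b ≡ + a ℤ.+ i → a ℕ.< b → 0ℤ ℤ.< i
+-gap-positive {a} {b} {i} b≡a+i a<b = ℤₚ.≰⇒> λ i≤0 → ℕₚ.<⇒≱ a<b (ℤₚ.drop‿+≤+ (begin
  + b          ≡⟨ b≡a+i ⟩
  + a ℤ.+ i    ≤⟨ ℤₚ.+-monoʳ-≤ (+ a) i≤0 ⟩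
  + a ℤ.+ 0ℤ   ≡⟨ ℤₚ.+-identityʳ (+ a) ⟩
  + a          ∎))
  where open ℤₚ.≤-Reasoning

count-xor : ∀ {k} (F S : Fin k → Bool) →
  + count (λ i → F i xor S i) ≡ + count F ℤ.+ ℤΣ.sum (ℤΣ.restrict S (λ i → if F i then -1ℤ else 1ℤ))
count-xor F S = begin
  + count (λ i → F i xor S i)
    ≡⟨ count-as-sum (λ i → F i xor S i) ⟩
  ℤΣ.sum (λ i → + indicator (F i xor S i))
    ≡⟨ ℤΣ.sum-cong-≗ (λ i → indicator-xor (F i) (S i)) ⟩
  ℤΣ.sum (λ i → + indicator (F i) ℤ.+ ℤΣ.restrict S w i)
    ≡⟨ ℤΣ.∑-distrib-+ (λ i → + indicator (F i)) (ℤΣ.restrict S w) ⟩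
  ℤΣ.sum (λ i → + indicator (F i)) ℤ.+ ℤΣ.sum (ℤΣ.restrict S w)
    ≡⟨ cong (ℤ._+ ℤΣ.sum (ℤΣ.restrict S w)) (sym (count-as-sum F)) ⟩
  + count F ℤ.+ ℤΣ.sum (ℤΣ.restrict S w) ∎
  where
  open ≡-Reasoning
  w = λ i → if F i then -1ℤ else 1ℤ
  count-as-sum : ∀ P → + count P ≡ ℤΣ.sum (λ i → + indicator (P i))
  count-as-sum P = ℤΣ.homomorphic-sum-allFin +_ refl ℤₚ.pos-+ (indicator ∘ P)
  indicator-xor : ∀ a b →
    + indicator (a xor b) ≡ + indicator a ℤ.+ (if b then (if a then -1ℤ else 1ℤ) else 0ℤ)
  indicator-xor true  true  = refl
  indicator-xor true  false = refl
  indicator-xor false true  = refl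
  indicator-xor false false = refl

module _ {G : Graph} where

  Joins-sym : ∀ {e u w} → Joins G e u w → Joins G e w u
  Joins-sym (inj₁ eq) = inj₂ eq
  Joins-sym (inj₂ eq) = inj₁ eq

  Joins-endpoint : ∀ {e u w a b} → Joins G e u w → Joins G e a b → u ≡ a ⊎ u ≡ b
  Joins-endpoint (inj₁ p) (inj₁ q) = inj₁ (cong proj₁ (trans (sym p) q))
  Joins-endpoint (inj₁ p) (inj₂ q) = inj₂ (cong proj₁ (trans (sym p) q))
  Joins-endpoint (inj₂ p) (inj₁ q) = inj₂ (cong proj₂ (trans (sym p) q))
  Joins-endpoint (inj₂ p) (inj₂ q) = inj₁ (cong proj₂ (trans (sym p) q))

  source∈vertices : ∀ {u v} (W : Walk G u v) → u ∈ vertices W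
  source∈vertices []           = here refl
  source∈vertices (step _ _ _) = here refl

  target∈vertices : ∀ {u v} (W : Walk G u v) → v ∈ vertices W
  target∈vertices []           = here refl
  target∈vertices (step _ _ W) = there (target∈vertices W)

  edge-∉-walk : ∀ {e u w a b} (W : Walk G a b) → Joins G e u w →
    All (u ≢_) (vertices W) → All (e ≢_) (edgesOf W)
  edge-∉-walk []               _ _           = []
  edge-∉-walk (step e′ j′ W) j (u≢a ∷ u∉W) = e≢e′ ∷ edge-∉-walk W j u∉W
    where
    e≢e′ : _ ≢ e′
    e≢e′ refl with Joins-endpoint j j′
    ... | inj₁ u≡a = u≢a u≡a
    ... | inj₂ u≡b = All.lookup u∉W (source∈vertices W) u≡b

  path-edges-unique : ∀ {u v} (P : Walk G u v) → IsPath P → Unique (edgesOf P)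
  path-edges-unique []             _             = []
  path-edges-unique (step e j P) (u∉P ∷ isPath) = edge-∉-walk P j u∉P ∷ path-edges-unique P isPath

  edge-isPath : ∀ {e u w} → u ≢ w → (j : Joins G e u w) → IsPath {G} (step e j [])
  edge-isPath u≢w j = (u≢w ∷ []) ∷ [] ∷ []

  path-avoids-or-is-edge : ∀ {e x y} → Joins G e x y → (P : Walk G x y) → IsPath P →
    All (e ≢_) (edgesOf P) ⊎ ∃[ j′ ] P ≡ step e j′ []
  path-avoids-or-is-edge j [] _ = inj₁ []
  path-avoids-or-is-edge {e} j (step e′ j′ P) (x∉P ∷ isPath) with e ≟ e′
  ... | no e≢e′ = inj₁ (e≢e′ ∷ edge-∉-walk P j x∉P)
  ... | yes refl with Joins-endpoint (Joins-sym j′) j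
  ...   | inj₁ w≡x = contradiction (sym w≡x) (All.lookup x∉P (source∈vertices P))
  path-avoids-or-is-edge j (step e′ j′ []) _ | yes refl | inj₂ _ = inj₂ (j′ , refl)
  path-avoids-or-is-edge j (step e′ j′ (step _ _ P)) (_ ∷ w∉P ∷ _) | yes refl | inj₂ w≡y =
    contradiction w≡y (All.lookup w∉P (target∈vertices P))

  -- The edge set of W when W repeats no edge.
  oddEdges : ∀ {u v} → Walk G u v → Edge G → Bool
  oddEdges []           i = false
  oddEdges (step e _ W) i = ⌊ i ≟ e ⌋ xor oddEdges W i

  oddEdges-∉ : ∀ {u v} (W : Walk G u v) {e} → All (e ≢_) (edgesOf W) → oddEdges W e ≡ false
  oddEdges-∉ []             []           = refl
  oddEdges-∉ (step e′ _ W) {e} (e≢e′ ∷ e∉W) with e ≟ e′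
  ... | no  _    = oddEdges-∉ W e∉W
  ... | yes e≡e′ = contradiction e≡e′ e≢e′

  oddEdges-step-self : ∀ {e u w v} (j : Joins G e u w) (W : Walk G w v) →
    All (e ≢_) (edgesOf W) → oddEdges (step e j W) e ≡ true
  oddEdges-step-self {e} _ W e∉W with e ≟ e
  ... | yes _   = cong (true xor_) (oddEdges-∉ W e∉W)
  ... | no e≢e = contradiction refl e≢e

  δ : Vtx G → Vtx G → Parity
  δ u v = ℕ.parity (indicator ⌊ u ≟ v ⌋)

  parity-incid : ∀ {e u w} → Joins G e u w → ∀ v → ℕ.parity (incid G e v) ≡ δ u v ℙ.+ δ w v
  parity-incid {e} {u} {w} (inj₁ eq) v rewrite eq =
    ℙₚ.+-homo-+ (indicator ⌊ u ≟ v ⌋) (indicator ⌊ w ≟ v ⌋)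
  parity-incid {e} {u} {w} (inj₂ eq) v rewrite eq =
    trans (ℙₚ.+-homo-+ (indicator ⌊ w ≟ v ⌋) (indicator ⌊ u ≟ v ⌋)) (ℙₚ.+-comm (δ w v) (δ u v))

  parity-degIn : ∀ S v → ℕ.parity (degIn G S v) ≡ ℙΣ.sum (ℙΣ.restrict S (λ i → ℕ.parity (incid G i v)))
  parity-degIn S v = trans (parity-sum-allFin (λ i → if S i then incid G i v else 0))
                           (ℙΣ.sum-cong-≗ {m G} (λ i → if-float ℕ.parity (S i)))

  parity-degIn-xor : ∀ A B v →
    ℕ.parity (degIn G (λ i → A i xor B i) v) ≡ ℕ.parity (degIn G A v) ℙ.+ ℕ.parity (degIn G B v)
  parity-degIn-xor A B v = begin
    ℕ.parity (degIn G (λ i → A i xor B i) v)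
      ≡⟨ parity-degIn (λ i → A i xor B i) v ⟩
    ℙΣ.sum (ℙΣ.restrict (λ i → A i xor B i) d)
      ≡⟨ ℙΣ.sum-restrict-xor A B d (λ i _ _ → ℙₚ.p+p≡0ℙ (d i)) ⟩
    ℙΣ.sum (ℙΣ.restrict A d) ℙ.+ ℙΣ.sum (ℙΣ.restrict B d)
      ≡⟨ sym (cong₂ ℙ._+_ (parity-degIn A v) (parity-degIn B v)) ⟩
    ℕ.parity (degIn G A v) ℙ.+ ℕ.parity (degIn G B v) ∎
    where
    open ≡-Reasoning
    d = λ i → ℕ.parity (incid G i v)

  parity-degIn-oddEdges : ∀ {u w} (W : Walk G u w) v →
    ℕ.parity (degIn G (oddEdges W) v) ≡ δ u v ℙ.+ δ w v
  parity-degIn-oddEdges {u} [] v =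
    trans (parity-degIn (λ _ → false) v)
          (trans (ℙΣ.sum-replicate-zero (m G)) (sym (ℙₚ.p+p≡0ℙ (δ u v))))
  parity-degIn-oddEdges {u} {w} (step {w = a} e j W) v = begin
    ℕ.parity (degIn G (λ i → ⌊ i ≟ e ⌋ xor oddEdges W i) v)
      ≡⟨ parity-degIn-xor (λ i → ⌊ i ≟ e ⌋) (oddEdges W) v ⟩
    ℕ.parity (degIn G (λ i → ⌊ i ≟ e ⌋) v) ℙ.+ ℕ.parity (degIn G (oddEdges W) v)
      ≡⟨ cong₂ ℙ._+_ parity-degIn-single (parity-degIn-oddEdges W v) ⟩
    ℕ.parity (incid G e v) ℙ.+ (δ a v ℙ.+ δ w v)
      ≡⟨ cong (ℙ._+ (δ a v ℙ.+ δ w v)) (parity-incid j v) ⟩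
    (δ u v ℙ.+ δ a v) ℙ.+ (δ a v ℙ.+ δ w v)
      ≡⟨ ℙ+-cancel-middle (δ u v) (δ a v) (δ w v) ⟩
    δ u v ℙ.+ δ w v ∎
    where
    open ≡-Reasoning
    parity-degIn-single : ℕ.parity (degIn G (λ i → ⌊ i ≟ e ⌋) v) ≡ ℕ.parity (incid G e v)
    parity-degIn-single =
      trans (parity-degIn (λ i → ⌊ i ≟ e ⌋) v) (ℙΣ.sum-restrict-singleton e (λ i → ℕ.parity (incid G i v)))

  IsJoin-xor-closedWalk : ∀ {T F y} → IsJoin G T F → (C : Walk G y y) →
    IsJoin G T (λ i → F i xor oddEdges C i)
  IsJoin-xor-closedWalk {F = F} {y} isJoin C v =
    trans (parity⇒%2≡ {degIn G (λ i → F i xor oddEdges C i) v} {degIn G F v} same-parity) (isJoin v)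
    where
    open ≡-Reasoning
    same-parity : ℕ.parity (degIn G (λ i → F i xor oddEdges C i) v) ≡ ℕ.parity (degIn G F v)
    same-parity = begin
      ℕ.parity (degIn G (λ i → F i xor oddEdges C i) v)
        ≡⟨ parity-degIn-xor F (oddEdges C) v ⟩
      ℕ.parity (degIn G F v) ℙ.+ ℕ.parity (degIn G (oddEdges C) v)
        ≡⟨ cong (ℕ.parity (degIn G F v) ℙ.+_) (parity-degIn-oddEdges C v) ⟩
      ℕ.parity (degIn G F v) ℙ.+ (δ y v ℙ.+ δ y v)
        ≡⟨ cong (ℕ.parity (degIn G F v) ℙ.+_) (ℙₚ.p+p≡0ℙ (δ y v)) ⟩
      ℕ.parity (degIn G F v) ℙ.+ 0ℙ
        ≡⟨ ℙₚ.+-identityʳ _ ⟩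
      ℕ.parity (degIn G F v) ∎

  sum-wt-oddEdges : ∀ (F : Edge G → Bool) {u v} (W : Walk G u v) → Unique (edgesOf W) →
    ℤΣ.sum (ℤΣ.restrict (oddEdges W) (wt {G} F)) ≡ wtWalk F W
  sum-wt-oddEdges F [] _ = ℤΣ.sum-replicate-zero (m G)
  sum-wt-oddEdges F (step e j W) (e∉W ∷ unique) = begin
    ℤΣ.sum (ℤΣ.restrict (λ i → ⌊ i ≟ e ⌋ xor oddEdges W i) (wt {G} F))
      ≡⟨ ℤΣ.sum-restrict-xor (λ i → ⌊ i ≟ e ⌋) (oddEdges W) (wt {G} F) disjoint ⟩
    ℤΣ.sum (ℤΣ.restrict (λ i → ⌊ i ≟ e ⌋) (wt {G} F)) ℤ.+ ℤΣ.sum (ℤΣ.restrict (oddEdges W) (wt {G} F))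
      ≡⟨ cong₂ ℤ._+_ (ℤΣ.sum-restrict-singleton e (wt {G} F)) (sum-wt-oddEdges F W unique) ⟩
    wt {G} F e ℤ.+ wtWalk F W ∎
    where
    open ≡-Reasoning
    disjoint : ∀ i → ⌊ i ≟ e ⌋ ≡ true → oddEdges W i ≡ true → wt {G} F i ℤ.+ wt {G} F i ≡ 0ℤ
    disjoint i i≡e i∈W with i ≟ e
    ... | yes refl = contradiction (trans (sym i∈W) (oddEdges-∉ W e∉W)) λ ()
    ... | no  _    = contradiction i≡e λ ()

  count-xor-oddEdges : ∀ (F : Edge G → Bool) {u v} (W : Walk G u v) → Unique (edgesOf W) →
    + count (λ i → F i xor oddEdges W i) ≡ + count F ℤ.+ wtWalk F W
  count-xor-oddEdges F W unique =
    trans (count-xor F (oddEdges W)) (cong (λ s → + count F ℤ.+ s) (sum-wt-oddEdges F W unique))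

module _ {G : Graph} (c : Vtx G → Bool)
         (proper : ∀ e → c (proj₁ (ends G e)) ≢ c (proj₂ (ends G e))) where

  colour-≢ : ∀ {e u w} → Joins G e u w → c u ≢ c w
  colour-≢ {e} (inj₁ eq) cu≡cw = proper e (subst (λ p → c (proj₁ p) ≡ c (proj₂ p)) (sym eq) cu≡cw)
  colour-≢ {e} (inj₂ eq) cu≡cw = proper e (subst (λ p → c (proj₁ p) ≡ c (proj₂ p)) (sym eq) (sym cu≡cw))

  wtWalk-OddIf : ∀ (F : Edge G → Bool) {u v} (W : Walk G u v) → OddIf (c u xor c v) (wtWalk F W)
  wtWalk-OddIf F {u} [] = subst (λ b → OddIf b (+ 0)) (sym (xor-same (c u))) (0ℤ , refl)
  wtWalk-OddIf F {u} {v} (step {w = w} e j W) =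
    subst (λ b → OddIf b (wtWalk F (step e j W))) colour-flip
          (OddIf-±1+ (F e) (c w xor c v) (wtWalk-OddIf F W))
    where
    colour-flip : not (c w xor c v) ≡ c u xor c v
    colour-flip = trans (not-distribˡ-xor (c w) (c v)) (cong (_xor c v) (sym (¬-not (colour-≢ j))))

  wtWalk-odd : ∀ (F : Edge G → Bool) {u v} (W : Walk G u v) → c u ≢ c v → OddIf true (wtWalk F W)
  wtWalk-odd F W cu≢cv = subst (λ b → OddIf b (wtWalk F W)) (xor-≢ cu≢cv) (wtWalk-OddIf F W)

module _ {G : Graph} {T : Vtx G → Bool} {F : Edge G → Bool} {e : Edge G}
         (¬allowed : ¬ Allowed G T e) (minF : IsMinJoin G T F) where

  count-<-¬Allowed : ∀ {F′} → IsJoin G T F′ → F′ e ≡ true → count F ℕ.< count F′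
  count-<-¬Allowed {F′} isJoin′ F′e = ℕₚ.≰⇒> λ F′≤F →
    ¬allowed (F′ , (isJoin′ , λ F″ isJoin″ → ℕₚ.≤-trans F′≤F (proj₂ minF F″ isJoin″)) , F′e)

  closedWalk-weight-positive : F e ≡ false → ∀ {y} (C : Walk G y y) → Unique (edgesOf C) →
    oddEdges C e ≡ true → 0ℤ ℤ.< wtWalk F C
  closedWalk-weight-positive Fe C unique e∈C = +-gap-positive (count-xor-oddEdges F C unique)
    (count-<-¬Allowed (IsJoin-xor-closedWalk (proj₁ minF) C) (cong₂ _xor_ Fe e∈C))

  path-weight-≥1 : F e ≡ false → Bipartite G → ∀ {x y} → Joins G e x y →
    (P : Walk G x y) → IsPath P → 1ℤ ℤ.≤ wtWalk F P
  path-weight-≥1 Fe (c , proper) j P isPath with path-avoids-or-is-edge j P isPath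
  ... | inj₂ (_ , refl) rewrite Fe = ℤₚ.≤-refl
  ... | inj₁ e∉P = odd-positive (wtWalk-odd c proper F P (colour-≢ c proper j))
    (subst (0ℤ ℤ.<_) cycle-weight
      (closedWalk-weight-positive Fe C (e∉P ∷ path-edges-unique P isPath)
                                        (oddEdges-step-self (Joins-sym {G} j) P e∉P)))
    where
    C : Walk G _ _
    C = step e (Joins-sym {G} j) P
    cycle-weight : wtWalk F C ≡ 1ℤ ℤ.+ wtWalk F P
    cycle-weight = cong (λ b → (if b then -1ℤ else 1ℤ) ℤ.+ wtWalk F P) Fe

mainTheorem13 : (G : Graph) (T : Vtx G → Bool) → IsGraft G T → Bipartite G →
    (e : Edge G) (x y : Vtx G) → x ≢ y → Joins G e x y → ¬ Allowed G T e →
    (F : Edge G → Bool) → IsMinJoin G T F → DistIs G F x y (+ 1)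
mainTheorem13 G T _ bipartite e x y x≢y j ¬allowed F minF with F e in Fe
... | true  = ⊥-elim (¬allowed (F , minF , Fe))
... | false = (step e j [] , edge-isPath {G} x≢y j , edge-weight)
            , path-weight-≥1 ¬allowed minF Fe bipartite j
  where
  edge-weight : wtWalk F (step {G} e j []) ≡ + 1
  edge-weight rewrite Fe = refl
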